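{- Let $\sim$ be an equivalence relation on $\mathbb{N}$. If every set $A\subseteq\mathbb{N}$ that is partially $\sim$-extensional and not universally $\sim$-extensional is non-recursive, then the identity family $\{(\lambda x.x)_{a,b}\}_{a,b\in\mathbb{N}}$ is an intricated switching family with respect to $\sim$.
   Context: For an equivalence $\sim$ on $\mathbb{N}$ with classes $[a]_\sim$, a set $A\subseteq\mathbb{N}$ is partially $\sim$-extensional if $[a]_\sim\subseteq A$ for some $a\in\mathbb{N}$, and universally $\sim$-extensional if $[a]_\sim\cap A\neq\varnothing$ for all $a\in\mathbb{N}$. Two sets $A,B\subseteq\mathbb{N}$ are recursively inseparable if there is no recursive set $C\subseteq\mathbb{N}$ with $A\subseteq C$ and $B\cap C=\varnothing$. An intricated switching family (ISF) w.r.t. $\sim$ is an indexed family $\{\sigma_{a,b}\}_{a,b\in\mathbb{N}}$ of total computable functions $\sigma_{a,b}:\mathbb{N}\to\mathbb{N}$ such that for all $a,b\in\mathbb{N}$ the sets $A_{a,b}=\{x\mid\sigma_{a,b}(x)\sim a\}$ and $B_{a,b}=\{x\mid\sigma_{a,b}(x)\sim b\}$ are recursively inseparable. -}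

module Defs where

open import Data.Nat using (ℕ; zero; suc; _<_)
open import Data.Fin using (Fin)
open import Data.Vec using (Vec; []; _∷_; lookup)
open import Data.Product using (Σ; _×_; ∃)
open import Data.Sum using (_⊎_)
open import Relation.Nullary using (¬_)
open import Relation.Binary using (IsEquivalence)

data PR : ℕ → Set where
  zeroF : ∀ {n} → PR n
  succF : PR 1
  proj  : ∀ {n} → Fin n → PR n
  comp  : ∀ {n m} → PR m → Vec (PR n) m → PR n
  prec  : ∀ {n} → PR n → PR (suc (suc n)) → PR (suc n)
  mu    : ∀ {n} → PR (suc n) → PR n

infix 4 _⟨_⟩⇓_ _⟨_⟩⇓*_
data _⟨_⟩⇓_ : ∀ {n} → PR n → Vec ℕ n → ℕ → Set
data _⟨_⟩⇓*_ : ∀ {n m} → Vec (PR n) m → Vec ℕ n → Vec ℕ m → Set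

data _⟨_⟩⇓_ where
  ev-zero : ∀ {n} {xs : Vec ℕ n} → zeroF ⟨ xs ⟩⇓ 0
  ev-succ : ∀ {x} → succF ⟨ x ∷ [] ⟩⇓ suc x
  ev-proj : ∀ {n} {i : Fin n} {xs} → proj i ⟨ xs ⟩⇓ lookup xs i
  ev-comp : ∀ {n m} {f : PR m} {gs : Vec (PR n) m} {xs ys y} →
            gs ⟨ xs ⟩⇓* ys → f ⟨ ys ⟩⇓ y → comp f gs ⟨ xs ⟩⇓ y
  ev-prec-zero : ∀ {n} {g : PR n} {h xs y} →
            g ⟨ xs ⟩⇓ y → prec g h ⟨ 0 ∷ xs ⟩⇓ y
  ev-prec-suc : ∀ {n} {g : PR n} {h k xs r y} →
            prec g h ⟨ k ∷ xs ⟩⇓ r → h ⟨ k ∷ r ∷ xs ⟩⇓ y →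
            prec g h ⟨ suc k ∷ xs ⟩⇓ y
  ev-mu : ∀ {n} {f : PR (suc n)} {xs y} →
            f ⟨ y ∷ xs ⟩⇓ 0 →
            (∀ z → z < y → Σ ℕ (λ w → f ⟨ z ∷ xs ⟩⇓ suc w)) →
            mu f ⟨ xs ⟩⇓ y

data _⟨_⟩⇓*_ where
  ev-[] : ∀ {n} {xs : Vec ℕ n} → [] ⟨ xs ⟩⇓* []
  ev-∷  : ∀ {n m} {g : PR n} {gs : Vec (PR n) m} {xs y ys} →
          g ⟨ xs ⟩⇓ y → gs ⟨ xs ⟩⇓* ys → (g ∷ gs) ⟨ xs ⟩⇓* (y ∷ ys)

TotalComputable : (ℕ → ℕ) → Set
TotalComputable f = Σ (PR 1) λ e → ∀ x → e ⟨ x ∷ [] ⟩⇓ f x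

Recursive : (ℕ → Set) → Set
Recursive C = Σ (PR 1) λ e → ∀ x →
  (e ⟨ x ∷ [] ⟩⇓ 1 × C x) ⊎ (e ⟨ x ∷ [] ⟩⇓ 0 × ¬ C x)

RecInseparable : (ℕ → Set) → (ℕ → Set) → Set₁
RecInseparable A B =
  ¬ (Σ (ℕ → Set) λ C → Recursive C × (∀ x → A x → C x) × (∀ x → B x → ¬ C x))

PartiallyExt : (ℕ → ℕ → Set) → (ℕ → Set) → Set
PartiallyExt _∼_ A = Σ ℕ λ a → ∀ x → x ∼ a → A x

UniversallyExt : (ℕ → ℕ → Set) → (ℕ → Set) → Set
UniversallyExt _∼_ A = ∀ a → Σ ℕ λ x → x ∼ a × A x

IsISF : (ℕ → ℕ → Set) → (ℕ → ℕ → ℕ → ℕ) → Set₁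
IsISF _∼_ σ =
  (∀ a b → TotalComputable (σ a b)) ×
  (∀ a b → RecInseparable (λ x → σ a b x ∼ a) (λ x → σ a b x ∼ b))

module Submission where

open import Defs
open import Data.Nat using (ℕ)
open import Data.Product using (_×_; _,_)
open import Data.Fin using (zero)
open import Relation.Nullary using (¬_)
open import Relation.Binary using (IsEquivalence)

-- A recursive separator C of the classes [a] and [b] contains [a] and misses [b],
-- so it is partially but not universally extensional; the hypothesis forbids that.

id-totalComputable : TotalComputable (λ x → x)
id-totalComputable = proj zero , λ x → ev-proj

module _ (_∼_ : ℕ → ℕ → Set) {C : ℕ → Set} where

  partiallyExt-⊇class : ∀ a → (∀ x → x ∼ a → C x) → PartiallyExt _∼_ C
  partiallyExt-⊇class a [a]⊆C = a , [a]⊆C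

  ¬universallyExt-disjoint : ∀ b → (∀ x → x ∼ b → ¬ C x) → ¬ UniversallyExt _∼_ C
  ¬universallyExt-disjoint b [b]∩C=∅ meetsAll with meetsAll b
  ... | x , x∼b , Cx = [b]∩C=∅ x x∼b Cx

mainTheorem4 : (_∼_ : ℕ → ℕ → Set) → IsEquivalence _∼_ →
    (∀ (A : ℕ → Set) → PartiallyExt _∼_ A → ¬ UniversallyExt _∼_ A → ¬ Recursive A) →
    IsISF _∼_ (λ a b x → x)
mainTheorem4 _∼_ _ noRecursivePartial =
  (λ a b → id-totalComputable) ,
  λ a b → λ (C , recC , [a]⊆C , [b]∩C=∅) →
    noRecursivePartial C
      (partiallyExt-⊇class _∼_ a [a]⊆C)
      (¬universallyExt-disjoint _∼_ b [b]∩C=∅)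
      recC
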